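{- Let $n\geq 1$, $G=([n],w)\in D(n)$, and let $u,v,z\in[n]$ satisfy $w(uv)=1$, $w(uz)=2$, $w(vz)=3$. Then $|\Gamma(G_{uv})|<|\Gamma(G)|$ or $|\Gamma(G_{vu})|<|\Gamma(G)|$.
   Context: A multigraph is $(V,w)$ with $w:\binom V2\to\mathbb{N}$; $\mu(G)=\max w$. An $(s,q)$-graph is one in which every $s$ vertices span total multiplicity at most $q$; $F(n,s,q)$ is the set of $(s,q)$-graphs on $[n]$. $D(n)=\{G\in F(n,4,15):\mu(G)\le 3\}\cap F(n,3,8)$. For distinct $x,y$, $G_{xy}=(V,w')$ has $w'(xy)=1$, $w'(xu)=w(yu)$ for $u\notin\{x,y\}$, and $w'=w$ on pairs not containing $x$. $\Gamma(G)$ is the set of 3-sets $\{a,b,c\}$ of vertices whose three pair multiplicities are $1,2,3$ in some order. -}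

module Defs where

open import Data.Nat using (ℕ; zero; suc; _+_; _≤_; _<ᵇ_; _≡ᵇ_)
open import Data.Fin using (Fin; toℕ; _≟_)
open import Data.Bool using (Bool; true; false; _∧_; _∨_; if_then_else_)
open import Data.List using (List; length; allFin; concatMap; filterᵇ; [_]; [])
open import Data.Product using (_×_; _,_)
open import Relation.Nullary using (¬_; does)
open import Relation.Binary.PropositionalEquality using (_≡_)

-- A multigraph on [n] = Fin n: a weight function on ordered pairs, required
-- (in the statement) to be symmetric.  Diagonal values are never used.
Weight : ℕ → Set
Weight n = Fin n → Fin n → ℕ

Symmetric : ∀ {n} → Weight n → Set
Symmetric {n} w = ∀ (x y : Fin n) → w x y ≡ w y x

MaxMult≤ : ∀ {n} → Weight n → ℕ → Set
MaxMult≤ {n} w k = ∀ (x y : Fin n) → ¬ x ≡ y → w x y ≤ k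

Is3Graph : ∀ {n} → Weight n → ℕ → Set
Is3Graph {n} w q = ∀ (a b c : Fin n) → ¬ a ≡ b → ¬ a ≡ c → ¬ b ≡ c →
  w a b + w a c + w b c ≤ q

Is4Graph : ∀ {n} → Weight n → ℕ → Set
Is4Graph {n} w q = ∀ (a b c d : Fin n) →
  ¬ a ≡ b → ¬ a ≡ c → ¬ a ≡ d → ¬ b ≡ c → ¬ b ≡ d → ¬ c ≡ d →
  w a b + w a c + w a d + w b c + w b d + w c d ≤ q

InD : ∀ {n} → Weight n → Set
InD w = Is4Graph w 15 × MaxMult≤ w 3 × Is3Graph w 8

merge : ∀ {n} → Weight n → Fin n → Fin n → Weight n
merge w x y a b =
  if does (a ≟ b) then w a b
  else if (does (a ≟ x) ∧ does (b ≟ y)) ∨ (does (a ≟ y) ∧ does (b ≟ x)) then 1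
  else if does (a ≟ x) then w y b
  else if does (b ≟ x) then w a y
  else w a b

is123 : ℕ → ℕ → ℕ → Bool
is123 p q r =
     ((p ≡ᵇ 1) ∧ (q ≡ᵇ 2) ∧ (r ≡ᵇ 3)) ∨ ((p ≡ᵇ 1) ∧ (q ≡ᵇ 3) ∧ (r ≡ᵇ 2))
  ∨ ((p ≡ᵇ 2) ∧ (q ≡ᵇ 1) ∧ (r ≡ᵇ 3)) ∨ ((p ≡ᵇ 2) ∧ (q ≡ᵇ 3) ∧ (r ≡ᵇ 1))
  ∨ ((p ≡ᵇ 3) ∧ (q ≡ᵇ 1) ∧ (r ≡ᵇ 2)) ∨ ((p ≡ᵇ 3) ∧ (q ≡ᵇ 2) ∧ (r ≡ᵇ 1))

triples : ∀ n → List (Fin n × Fin n × Fin n)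
triples n =
  concatMap (λ a → concatMap (λ b → concatMap (λ c →
    if (toℕ a <ᵇ toℕ b) ∧ (toℕ b <ᵇ toℕ c) then [ (a , b , c) ] else [])
    (allFin n)) (allFin n)) (allFin n)

inΓ : ∀ {n} → Weight n → Fin n × Fin n × Fin n → Bool
inΓ w (a , b , c) = is123 (w a b) (w a c) (w b c)

Γsize : ∀ {n} → Weight n → ℕ
Γsize {n} w = length (filterᵇ (inΓ w) (triples n))

-- In G_uv the vertices u and v become twins: every c ∉ {u, v} sees both with multiplicity
-- w(vc).  So no triangle through u and v is in Γ(G_uv) (two of its multiplicities agree), a
-- triangle avoiding u keeps its multiplicities, and a triangle avoiding v has the
-- multiplicities of its image under the transposition (u v) in G.  With the symmetric
-- statements for G_vu, triangle by triangle |Γ(G_uv)| + |Γ(G_vu)| ≤ |Γ(G)| + |Γ((u v)G)|,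
-- strictly at uvz ∈ Γ(G), hence |Γ(G_uv)| + |Γ(G_vu)| < 2|Γ(G)|.  Since (u v) does not
-- respect the enumeration a < b < c behind Γsize, the count runs over ordered triples,
-- which count every triangle six times.

module Submission where

open import Defs
open import Data.Bool using (Bool; true; false; T; not; _∧_; _∨_; if_then_else_)
open import Data.Bool.Properties using (T?; T-∨; T-∧; ∧-zeroʳ)
open import Data.Empty using (⊥; ⊥-elim)
open import Data.Fin using (Fin; zero; suc; toℕ; _≟_)
open import Data.Fin.Properties using (toℕ-injective)
open import Data.Fin.Permutation as Perm using (Permutation; _⟨$⟩ʳ_)
open import Data.Fin.Permutation.Components using (transpose)
open import Data.List using (List; []; _∷_; _++_; [_]; length; tabulate; allFin; concatMap; filterᵇ)
open import Data.List.Properties using (length-++; filter-++)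
open import Data.List.Membership.Propositional using (_∈_; _∉_)
open import Data.List.Relation.Unary.Any using (here; there; any?)
open import Data.Nat using (ℕ; zero; suc; _+_; _*_; _≤_; _<_; _≥_; _<ᵇ_; _≡ᵇ_; z≤n; z<s)
import Data.Nat as ℕ
open import Data.Nat.Properties
  using ( ≡ᵇ⇒≡; <ᵇ⇒<; <⇒<ᵇ; ≮⇒≥; ≤∧≢⇒<; <-trans; <-irrefl; ≤-reflexive; ≤-trans
        ; m≤m+n; +-comm; +-mono-≤; +-mono-<-≤; +-mono-≤-<; +-monoˡ-≤; +-cancelˡ-<
        ; *-zeroʳ; *-identityˡ; *-distribˡ-+; *-cancelˡ-<; ≤-<-trans
        ; +-0-commutativeMonoid; module ≤-Reasoning )
open import Data.Nat.Tactic.RingSolver using (solve-∀)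
open import Algebra.Properties.CommutativeMonoid.Sum +-0-commutativeMonoid
  using (sum; sum-cong-≗; ∑-distrib-+; ∑-comm; sum-permute)
open import Data.Product using (_×_; _,_; proj₂)
open import Data.Sum using (_⊎_; inj₁; inj₂)
open import Function using (id; _∘_; _⇔_; mk⇔; Equivalence)
open import Relation.Nullary using (¬_; Dec; yes; no; does; ¬?; _×-dec_)
open import Relation.Nullary.Decidable using (dec-true; dec-false)
open import Relation.Binary.PropositionalEquality
  using (_≡_; _≢_; refl; sym; trans; cong; cong₂; subst; ≢-sym; module ≡-Reasoning)

𝟙 : Bool → ℕ
𝟙 true  = 1
𝟙 false = 0

𝟙-true : ∀ {b} → T b → 𝟙 b ≡ 1
𝟙-true {true} _ = refl

𝟙-false : ∀ {b} → ¬ T b → 𝟙 b ≡ 0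
𝟙-false {false} _  = refl
𝟙-false {true}  ¬b = ⊥-elim (¬b _)

T-injective : ∀ {x y} → T x ⇔ T y → x ≡ y
T-injective {false} {false} _   = refl
T-injective {false} {true}  x⇔y = ⊥-elim (Equivalence.from x⇔y _)
T-injective {true}  {false} x⇔y = ⊥-elim (Equivalence.to x⇔y _)
T-injective {true}  {true}  _   = refl

data Perm123 : ℕ → ℕ → ℕ → Set where
  p123 : Perm123 1 2 3
  p132 : Perm123 1 3 2
  p213 : Perm123 2 1 3
  p231 : Perm123 2 3 1
  p312 : Perm123 3 1 2
  p321 : Perm123 3 2 1

module _ {p q r : ℕ} where

  Perm123-swap₁₂ : Perm123 p q r → Perm123 q p r
  Perm123-swap₁₂ p123 = p213
  Perm123-swap₁₂ p132 = p312
  Perm123-swap₁₂ p213 = p123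
  Perm123-swap₁₂ p231 = p321
  Perm123-swap₁₂ p312 = p132
  Perm123-swap₁₂ p321 = p231

  Perm123-swap₂₃ : Perm123 p q r → Perm123 p r q
  Perm123-swap₂₃ p123 = p132
  Perm123-swap₂₃ p132 = p123
  Perm123-swap₂₃ p213 = p231
  Perm123-swap₂₃ p231 = p213
  Perm123-swap₂₃ p312 = p321
  Perm123-swap₂₃ p321 = p312

  Perm123-distinct : Perm123 p q r → p ≢ q × p ≢ r × q ≢ r
  Perm123-distinct p123 = (λ ()) , (λ ()) , (λ ())
  Perm123-distinct p132 = (λ ()) , (λ ()) , (λ ())
  Perm123-distinct p213 = (λ ()) , (λ ()) , (λ ())
  Perm123-distinct p231 = (λ ()) , (λ ()) , (λ ())
  Perm123-distinct p312 = (λ ()) , (λ ()) , (λ ())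
  Perm123-distinct p321 = (λ ()) , (λ ()) , (λ ())

  Perm123⇒is123 : Perm123 p q r → T (is123 p q r)
  Perm123⇒is123 p123 = _
  Perm123⇒is123 p132 = _
  Perm123⇒is123 p213 = _
  Perm123⇒is123 p231 = _
  Perm123⇒is123 p312 = _
  Perm123⇒is123 p321 = _

  is123⇒Perm123 : T (is123 p q r) → Perm123 p q r
  is123⇒Perm123 =
    disjunct p123 ∨ᵀ disjunct p132 ∨ᵀ disjunct p213 ∨ᵀ disjunct p231 ∨ᵀ disjunct p312 ∨ᵀ disjunct p321
    where
    infixr 4 _∨ᵀ_
    disjunct : ∀ {a b c} → Perm123 a b c → T ((p ≡ᵇ a) ∧ (q ≡ᵇ b) ∧ (r ≡ᵇ c)) → Perm123 p q r
    disjunct {a} {b} {c} π h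
      with hp , hqr ← Equivalence.to T-∧ h
      with hq , hr ← Equivalence.to T-∧ hqr
      with refl ← ≡ᵇ⇒≡ p a hp | refl ← ≡ᵇ⇒≡ q b hq | refl ← ≡ᵇ⇒≡ r c hr = π
    _∨ᵀ_ : ∀ {x y} → (T x → Perm123 p q r) → (T y → Perm123 p q r) → T (x ∨ y) → Perm123 p q r
    (f ∨ᵀ g) h with Equivalence.to T-∨ h
    ... | inj₁ hx = f hx
    ... | inj₂ hy = g hy

is123-≡ : ∀ {p q r p′ q′ r′} →
  (Perm123 p q r → Perm123 p′ q′ r′) → (Perm123 p′ q′ r′ → Perm123 p q r) →
  is123 p q r ≡ is123 p′ q′ r′
is123-≡ {p} {q} {r} {p′} {q′} {r′} to from =
  T-injective (mk⇔ (Perm123⇒is123 ∘ to ∘ is123⇒Perm123 {p} {q} {r})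
                   (Perm123⇒is123 ∘ from ∘ is123⇒Perm123 {p′} {q′} {r′}))

is123-swap₁₂ : ∀ p q r → is123 p q r ≡ is123 q p r
is123-swap₁₂ p q r = is123-≡ {p} {q} {r} Perm123-swap₁₂ Perm123-swap₁₂

is123-swap₂₃ : ∀ p q r → is123 p q r ≡ is123 p r q
is123-swap₂₃ p q r = is123-≡ {p} {q} {r} Perm123-swap₂₃ Perm123-swap₂₃

sym₃ : ∀ {A : Set} → (A → A → A → ℕ) → A → A → A → ℕ
sym₃ f a b c = f a b c + f a c b + f b a c + f b c a + f c a b + f c b a

ascendingℕ : ℕ → ℕ → ℕ → ℕ
ascendingℕ x y z = 𝟙 ((x <ᵇ y) ∧ (y <ᵇ z))

sym₃-factorʳ : ∀ {A : Set} (f g : A → A → A → ℕ) →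
  (∀ a b c → g b a c ≡ g a b c) → (∀ a b c → g a c b ≡ g a b c) →
  ∀ a b c → sym₃ (λ a b c → f a b c * g a b c) a b c ≡ sym₃ f a b c * g a b c
sym₃-factorʳ f g g₁₂ g₂₃ a b c =
  factor (f a b c) (f a c b) (f b a c) (f b c a) (f c a b) (f c b a) (g₂₃ a b c) (g₁₂ a b c) bca cab cba
  where
  bca : g b c a ≡ g a b c
  bca = trans (g₂₃ b a c) (g₁₂ a b c)
  cab : g c a b ≡ g a b c
  cab = trans (g₁₂ a c b) (g₂₃ a b c)
  cba : g c b a ≡ g a b c
  cba = trans (g₁₂ b c a) bca
  distrib : ∀ s₁ s₂ s₃ s₄ s₅ s₆ x →
    s₁ * x + s₂ * x + s₃ * x + s₄ * x + s₅ * x + s₆ * x ≡ (s₁ + s₂ + s₃ + s₄ + s₅ + s₆) * x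
  distrib = solve-∀
  factor : ∀ {x x₂ x₃ x₄ x₅ x₆} s₁ s₂ s₃ s₄ s₅ s₆ → x₂ ≡ x → x₃ ≡ x → x₄ ≡ x → x₅ ≡ x → x₆ ≡ x →
    s₁ * x + s₂ * x₂ + s₃ * x₃ + s₄ * x₄ + s₅ * x₅ + s₆ * x₆ ≡ (s₁ + s₂ + s₃ + s₄ + s₅ + s₆) * x
  factor {x} s₁ s₂ s₃ s₄ s₅ s₆ refl refl refl refl refl = distrib s₁ s₂ s₃ s₄ s₅ s₆ x

<ᵇ-flip : ∀ {x y} → x ≢ y → (y <ᵇ x) ≡ not (x <ᵇ y)
<ᵇ-flip {zero}  {zero}  x≢y = ⊥-elim (x≢y refl)
<ᵇ-flip {zero}  {suc y} _   = refl
<ᵇ-flip {suc x} {zero}  _   = refl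
<ᵇ-flip {suc x} {suc y} x≢y = <ᵇ-flip (x≢y ∘ cong suc)

<ᵇ≡true⇒< : ∀ {x y} → (x <ᵇ y) ≡ true → x < y
<ᵇ≡true⇒< {x} {y} x<ᵇy = <ᵇ⇒< x y (subst T (sym x<ᵇy) _)

<ᵇ≡false⇒> : ∀ {x y} → x ≢ y → (x <ᵇ y) ≡ false → y < x
<ᵇ≡false⇒> {x} {y} x≢y x≮ᵇy =
  ≤∧≢⇒< (≮⇒≥ (λ x<y → subst T x≮ᵇy (<⇒<ᵇ x<y))) (x≢y ∘ sym)

<-cycle : ∀ {a b c} → a < b → b < c → c < a → ⊥
<-cycle a<b b<c c<a = <-irrefl refl (<-trans a<b (<-trans b<c c<a))

exactly-one-ascending : ∀ {x y z} → x ≢ y → x ≢ z → y ≢ z → sym₃ ascendingℕ x y z ≡ 1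
exactly-one-ascending {x} {y} {z} x≢y x≢z y≢z
  rewrite <ᵇ-flip x≢y | <ᵇ-flip x≢z | <ᵇ-flip y≢z
  with x <ᵇ y in x<y | x <ᵇ z in x<z | y <ᵇ z in y<z
... | true  | true  | true  = refl
... | true  | true  | false = refl
... | true  | false | true  = ⊥-elim (<-cycle (<ᵇ≡true⇒< x<y) (<ᵇ≡true⇒< y<z) (<ᵇ≡false⇒> x≢z x<z))
... | true  | false | false = refl
... | false | true  | true  = refl
... | false | true  | false = ⊥-elim (<-cycle (<ᵇ≡true⇒< x<z) (<ᵇ≡false⇒> y≢z y<z) (<ᵇ≡false⇒> x≢y x<y))
... | false | false | true  = refl
... | false | false | false = refl

sum-mono-≤ : ∀ {n} {f g : Fin n → ℕ} → (∀ i → f i ≤ g i) → sum f ≤ sum g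
sum-mono-≤ {zero}  _   = z≤n
sum-mono-≤ {suc n} f≤g = +-mono-≤ (f≤g zero) (sum-mono-≤ (f≤g ∘ suc))

sum-mono-< : ∀ {n} {f g : Fin n → ℕ} → (∀ i → f i ≤ g i) → ∀ j → f j < g j → sum f < sum g
sum-mono-< f≤g zero    f<g = +-mono-<-≤ f<g (sum-mono-≤ (f≤g ∘ suc))
sum-mono-< f≤g (suc j) f<g = +-mono-≤-< (f≤g zero) (sum-mono-< (f≤g ∘ suc) j f<g)

module _ {n : ℕ} where

  Σ³ : (Fin n → Fin n → Fin n → ℕ) → ℕ
  Σ³ f = sum λ a → sum λ b → sum λ c → f a b c

  Σ³-cong : ∀ {f g} → (∀ a b c → f a b c ≡ g a b c) → Σ³ f ≡ Σ³ g
  Σ³-cong f≡g = sum-cong-≗ λ a → sum-cong-≗ λ b → sum-cong-≗ (f≡g a b)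

  Σ³-distrib-+ : ∀ f g → Σ³ (λ a b c → f a b c + g a b c) ≡ Σ³ f + Σ³ g
  Σ³-distrib-+ f g = trans (sum-cong-≗ inner) (∑-distrib-+ (λ a → Σ² (f a)) (λ a → Σ² (g a)))
    where
    Σ² : (Fin n → Fin n → ℕ) → ℕ
    Σ² h = sum λ b → sum (h b)
    inner : ∀ a → Σ² (λ b c → f a b c + g a b c) ≡ Σ² (f a) + Σ² (g a)
    inner a = trans (sum-cong-≗ λ b → ∑-distrib-+ (f a b) (g a b))
                    (∑-distrib-+ (λ b → sum (f a b)) (λ b → sum (g a b)))

  Σ³-+-cong : ∀ {f g x y} → Σ³ f ≡ x → Σ³ g ≡ y → Σ³ (λ a b c → f a b c + g a b c) ≡ x + y
  Σ³-+-cong {f} {g} Σf≡x Σg≡y = trans (Σ³-distrib-+ f g) (cong₂ _+_ Σf≡x Σg≡y)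

  Σ³-swap₁₂ : ∀ f → Σ³ (λ a b c → f b a c) ≡ Σ³ f
  Σ³-swap₁₂ f = ∑-comm λ a b → sum (f b a)

  Σ³-swap₂₃ : ∀ f → Σ³ (λ a b c → f a c b) ≡ Σ³ f
  Σ³-swap₂₃ f = sum-cong-≗ λ a → ∑-comm λ b c → f a c b

  Σ³-sym₃ : ∀ f → Σ³ (sym₃ f) ≡ 6 * Σ³ f
  Σ³-sym₃ f =
    trans (Σ³-+-cong (Σ³-+-cong (Σ³-+-cong (Σ³-+-cong (Σ³-+-cong refl acb) bac) bca) cab) cba)
          (sixfold (Σ³ f))
    where
    acb = Σ³-swap₂₃ f
    bac = Σ³-swap₁₂ f
    bca = trans (Σ³-swap₁₂ (λ a b c → f a c b)) acb
    cab = trans (Σ³-swap₂₃ (λ a b c → f b a c)) bac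
    cba = trans (Σ³-swap₁₂ (λ a b c → f c a b)) cab
    sixfold : ∀ x → x + x + x + x + x + x ≡ 6 * x
    sixfold = solve-∀

  Σ³-permute : ∀ f (π : Permutation n n) →
    Σ³ (λ a b c → f (π ⟨$⟩ʳ a) (π ⟨$⟩ʳ b) (π ⟨$⟩ʳ c)) ≡ Σ³ f
  Σ³-permute f π = sym (begin
    Σ³ f
      ≡⟨ sum-permute (λ a → sum λ b → sum (f a b)) π ⟩
    (sum λ a → sum λ b → sum (f (π ⟨$⟩ʳ a) b))
      ≡⟨ sum-cong-≗ (λ a → sum-permute (λ b → sum (f (π ⟨$⟩ʳ a) b)) π) ⟩
    (sum λ a → sum λ b → sum (f (π ⟨$⟩ʳ a) (π ⟨$⟩ʳ b)))
      ≡⟨ sum-cong-≗ (λ a → sum-cong-≗ λ b → sum-permute (f (π ⟨$⟩ʳ a) (π ⟨$⟩ʳ b)) π) ⟩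
    Σ³ (λ a b c → f (π ⟨$⟩ʳ a) (π ⟨$⟩ʳ b) (π ⟨$⟩ʳ c)) ∎)
    where open ≡-Reasoning

  Σ³-mono-< : ∀ {f g} → (∀ a b c → f a b c ≤ g a b c) →
    ∀ a b c → f a b c < g a b c → Σ³ f < Σ³ g
  Σ³-mono-< f≤g a b c f<g =
    sum-mono-< (λ a → sum-mono-≤ λ b → sum-mono-≤ (f≤g a b)) a
      (sum-mono-< (λ b → sum-mono-≤ (f≤g a b)) b (sum-mono-< (f≤g a b) c f<g))

length-filterᵇ-++ : ∀ {A : Set} (p : A → Bool) xs ys →
  length (filterᵇ p (xs ++ ys)) ≡ length (filterᵇ p xs) + length (filterᵇ p ys)
length-filterᵇ-++ p xs ys = trans (cong length (filter-++ (T? ∘ p) xs ys)) (length-++ (filterᵇ p xs))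

length-filterᵇ-concatMap : ∀ {A B : Set} {n} (p : B → Bool) (f : A → List B) (g : Fin n → A) →
  length (filterᵇ p (concatMap f (tabulate g))) ≡ sum (λ i → length (filterᵇ p (f (g i))))
length-filterᵇ-concatMap {n = zero}  p f g = refl
length-filterᵇ-concatMap {n = suc n} p f g =
  trans (length-filterᵇ-++ p (f (g zero)) _)
        (cong (length (filterᵇ p (f (g zero))) +_) (length-filterᵇ-concatMap p f (g ∘ suc)))

length-filterᵇ-if : ∀ {A : Set} (p : A → Bool) b x →
  length (filterᵇ p (if b then [ x ] else [])) ≡ 𝟙 b * 𝟙 (p x)
length-filterᵇ-if p false x = refl
length-filterᵇ-if p true  x with p x
... | true  = refl
... | false = refl

module _ {n : ℕ} where

  γ : Weight n → Fin n → Fin n → Fin n → ℕ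
  γ W a b c = 𝟙 (inΓ W (a , b , c))

  ascending : Fin n → Fin n → Fin n → ℕ
  ascending a b c = ascendingℕ (toℕ a) (toℕ b) (toℕ c)

  Distinct : Fin n → Fin n → Fin n → Set
  Distinct a b c = a ≢ b × a ≢ c × b ≢ c

  distinct? : ∀ a b c → Dec (Distinct a b c)
  distinct? a b c = ¬? (a ≟ b) ×-dec ¬? (a ≟ c) ×-dec ¬? (b ≟ c)

  Γsize≡Σ³ : ∀ W → Γsize W ≡ Σ³ (λ a b c → ascending a b c * γ W a b c)
  Γsize≡Σ³ W =
    trans (length-filterᵇ-concatMap (inΓ W) layer₁ id) (sum-cong-≗ λ a →
    trans (length-filterᵇ-concatMap (inΓ W) (layer₂ a) id) (sum-cong-≗ λ b →
    trans (length-filterᵇ-concatMap (inΓ W) (layer₃ a b) id) (sum-cong-≗ λ c →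
    length-filterᵇ-if (inΓ W) ((toℕ a <ᵇ toℕ b) ∧ (toℕ b <ᵇ toℕ c)) (a , b , c))))
    where
    layer₃ : Fin n → Fin n → Fin n → List (Fin n × Fin n × Fin n)
    layer₃ a b c = if (toℕ a <ᵇ toℕ b) ∧ (toℕ b <ᵇ toℕ c) then [ (a , b , c) ] else []
    layer₂ : Fin n → Fin n → List (Fin n × Fin n × Fin n)
    layer₂ a b = concatMap (layer₃ a b) (allFin n)
    layer₁ : Fin n → List (Fin n × Fin n × Fin n)
    layer₁ a = concatMap (layer₂ a) (allFin n)

  module _ {W : Weight n} (W-sym : Symmetric W) where

    γ-swap₁₂ : ∀ a b c → γ W b a c ≡ γ W a b c
    γ-swap₁₂ a b c rewrite W-sym b a = cong 𝟙 (is123-swap₂₃ (W a b) (W b c) (W a c))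

    γ-swap₂₃ : ∀ a b c → γ W a c b ≡ γ W a b c
    γ-swap₂₃ a b c rewrite W-sym c b = cong 𝟙 (is123-swap₁₂ (W a c) (W a b) (W b c))

    inΓ⇒Distinct : ∀ {a b c} → T (inΓ W (a , b , c)) → Distinct a b c
    inΓ⇒Distinct {a} {b} {c} abc∈Γ
      with ab≢ac , ab≢bc , ac≢bc ← Perm123-distinct (is123⇒Perm123 {W a b} {W a c} {W b c} abc∈Γ) =
      (λ { refl → ac≢bc refl }) , (λ { refl → ab≢bc (W-sym a b) }) , (λ { refl → ab≢ac refl })

    γ-degenerate : ∀ {a b c} → ¬ Distinct a b c → γ W a b c ≡ 0
    γ-degenerate ¬distinct = 𝟙-false (¬distinct ∘ inΓ⇒Distinct)

    γ≡sym₃-ascending : ∀ a b c → γ W a b c ≡ sym₃ (λ a b c → ascending a b c * γ W a b c) a b c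
    γ≡sym₃-ascending a b c = begin
      γ W a b c                             ≡⟨ counted-once ⟩
      sym₃ ascending a b c * γ W a b c      ≡⟨ sym₃-factorʳ ascending (γ W) γ-swap₁₂ γ-swap₂₃ a b c ⟨
      sym₃ (λ a b c → ascending a b c * γ W a b c) a b c ∎
      where
      open ≡-Reasoning
      counted-once : γ W a b c ≡ sym₃ ascending a b c * γ W a b c
      counted-once with T? (inΓ W (a , b , c))
      ... | yes abc∈Γ with a≢b , a≢c , b≢c ← inΓ⇒Distinct abc∈Γ = sym (trans
            (cong (_* γ W a b c) (exactly-one-ascending
              (a≢b ∘ toℕ-injective) (a≢c ∘ toℕ-injective) (b≢c ∘ toℕ-injective)))
            (*-identityˡ (γ W a b c)))
      ... | no abc∉Γ rewrite 𝟙-false abc∉Γ = sym (*-zeroʳ (sym₃ ascending a b c))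

    Σ³-γ : Σ³ (γ W) ≡ 6 * Γsize W
    Σ³-γ = begin
      Σ³ (γ W)                           ≡⟨ Σ³-cong γ≡sym₃-ascending ⟩
      Σ³ (sym₃ ascending*γ)              ≡⟨ Σ³-sym₃ ascending*γ ⟩
      6 * Σ³ ascending*γ                 ≡⟨ cong (6 *_) (Γsize≡Σ³ W) ⟨
      6 * Γsize W                        ∎
      where
      open ≡-Reasoning
      ascending*γ : Fin n → Fin n → Fin n → ℕ
      ascending*γ a b c = ascending a b c * γ W a b c

module _ {n : ℕ} where

  transpose-source : ∀ (i j : Fin n) → transpose i j i ≡ j
  transpose-source i j rewrite dec-true (i ≟ i) refl = refl

  transpose-fixes : ∀ {i j k : Fin n} → k ≢ i → k ≢ j → transpose i j k ≡ k
  transpose-fixes {i} {j} {k} k≢i k≢j rewrite dec-false (k ≟ i) k≢i | dec-false (k ≟ j) k≢j = refl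

  transpose-comm : ∀ (i j k : Fin n) → transpose i j k ≡ transpose j i k
  transpose-comm i j k with k ≟ i | k ≟ j
  ... | yes refl | yes refl = refl
  ... | yes refl | no _     rewrite dec-true (k ≟ k) refl = refl
  ... | no _     | yes refl rewrite dec-true (k ≟ k) refl = refl
  ... | no k≢i   | no k≢j   rewrite dec-false (k ≟ i) k≢i | dec-false (k ≟ j) k≢j = refl

module _ {n : ℕ} (w : Weight n) {x y : Fin n} where

  merge-away-from-source : ∀ {a b} → a ≢ x → b ≢ x → merge w x y a b ≡ w a b
  merge-away-from-source {a} {b} a≢x b≢x
    rewrite dec-false (a ≟ x) a≢x | dec-false (b ≟ x) b≢x | ∧-zeroʳ (does (a ≟ y))
    with does (a ≟ b)
  ... | true  = refl
  ... | false = refl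

  merge-away-from-target : ∀ {a b} → a ≢ b → a ≢ y → b ≢ y →
    merge w x y a b ≡ w (transpose x y a) (transpose x y b)
  merge-away-from-target {a} {b} a≢b a≢y b≢y with a ≟ x | b ≟ x
  ... | yes refl | yes refl = ⊥-elim (a≢b refl)
  ... | yes refl | no b≢x
    rewrite dec-false (a ≟ b) a≢b | dec-false (b ≟ y) b≢y | dec-false (a ≟ y) a≢y = refl
  ... | no a≢x   | yes refl
    rewrite dec-false (a ≟ b) a≢b | dec-false (a ≟ y) a≢y = refl
  ... | no _     | no _
    rewrite dec-false (a ≟ b) a≢b | ∧-zeroʳ (does (a ≟ y))
          | dec-false (a ≟ y) a≢y | dec-false (b ≟ y) b≢y = refl

  merge-joined : x ≢ y → merge w x y x y ≡ 1
  merge-joined x≢y rewrite dec-false (x ≟ y) x≢y | dec-true (x ≟ x) refl | dec-true (y ≟ y) refl = refl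

  merge-joined′ : x ≢ y → merge w x y y x ≡ 1
  merge-joined′ x≢y
    rewrite dec-false (y ≟ x) (≢-sym x≢y) | dec-true (x ≟ x) refl | dec-true (y ≟ y) refl = refl

  merge-twins : ∀ {c} → x ≢ y → c ≢ x → c ≢ y → merge w x y x c ≡ merge w x y y c
  merge-twins {c} x≢y c≢x c≢y = begin
    merge w x y x c                          ≡⟨ merge-away-from-target (≢-sym c≢x) x≢y c≢y ⟩
    w (transpose x y x) (transpose x y c)    ≡⟨ cong₂ w (transpose-source x y) (transpose-fixes c≢x c≢y) ⟩
    w y c                                    ≡⟨ merge-away-from-source (≢-sym x≢y) c≢x ⟨
    merge w x y y c                          ∎
    where open ≡-Reasoning

  merge-symmetric : Symmetric w → x ≢ y → Symmetric (merge w x y)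
  merge-symmetric w-sym x≢y a b = by-cases (a ≟ b) (a ≟ x) (b ≟ x) (a ≟ y) (b ≟ y)
    where
    by-cases : ∀ {a b} → Dec (a ≡ b) → Dec (a ≡ x) → Dec (b ≡ x) → Dec (a ≡ y) → Dec (b ≡ y) →
      merge w x y a b ≡ merge w x y b a
    by-cases (yes refl) _ _ _ _ = refl
    by-cases (no _) (no a≢x) (no b≢x) _ _ =
      trans (merge-away-from-source a≢x b≢x) (trans (w-sym _ _) (sym (merge-away-from-source b≢x a≢x)))
    by-cases (no a≢b) _ _ (no a≢y) (no b≢y) =
      trans (merge-away-from-target a≢b a≢y b≢y)
            (trans (w-sym _ _) (sym (merge-away-from-target (≢-sym a≢b) b≢y a≢y)))
    by-cases (no _) (yes refl) _ _ (yes refl) = trans (merge-joined x≢y) (sym (merge-joined′ x≢y))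
    by-cases (no _) _ (yes refl) (yes refl) _ = trans (merge-joined′ x≢y) (sym (merge-joined x≢y))
    by-cases (no _) (yes a≡x) _ (yes a≡y) _ = ⊥-elim (x≢y (trans (sym a≡x) a≡y))
    by-cases (no _) _ (yes b≡x) _ (yes b≡y) = ⊥-elim (x≢y (trans (sym b≡x) b≡y))

module _ {n : ℕ} where

  γ-cong : ∀ {W W′ : Weight n} {a b c a′ b′ c′} →
    W a b ≡ W′ a′ b′ → W a c ≡ W′ a′ c′ → W b c ≡ W′ b′ c′ → γ W a b c ≡ γ W′ a′ b′ c′
  γ-cong ab ac bc rewrite ab | ac | bc = refl

  γ-resp-≗ : ∀ (W : Weight n) {f g : Fin n → Fin n} → (∀ i → f i ≡ g i) →
    ∀ a b c → γ W (f a) (f b) (f c) ≡ γ W (g a) (g b) (g c)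
  γ-resp-≗ W f≗g a b c rewrite f≗g a | f≗g b | f≗g c = refl

  γ-twins : ∀ {W : Weight n} {x y c} → W x c ≡ W y c → γ W x y c ≡ 0
  γ-twins {W} {x} {y} {c} xc≡yc =
    𝟙-false λ xyc∈Γ → proj₂ (proj₂ (Perm123-distinct (is123⇒Perm123 {W x y} {W x c} {W y c} xyc∈Γ))) xc≡yc

  ∉⇒≢ : ∀ {x a b c : Fin n} → x ∉ a ∷ b ∷ c ∷ [] → a ≢ x × b ≢ x × c ≢ x
  ∉⇒≢ x∉ = (λ a≡x → x∉ (here (sym a≡x)))
         , (λ b≡x → x∉ (there (here (sym b≡x))))
         , (λ c≡x → x∉ (there (there (here (sym c≡x)))))

  module _ (w : Weight n) {x y : Fin n} where

    γ-merge-away-from-source : ∀ {a b c} → x ∉ a ∷ b ∷ c ∷ [] → γ (merge w x y) a b c ≡ γ w a b c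
    γ-merge-away-from-source {a} {b} {c} x∉ with a≢x , b≢x , c≢x ← ∉⇒≢ x∉ =
      γ-cong {merge w x y} {w} {a} {b} {c}
        (merge-away-from-source w a≢x b≢x) (merge-away-from-source w a≢x c≢x)
        (merge-away-from-source w b≢x c≢x)

    γ-merge-away-from-target : ∀ {a b c} → Distinct a b c → y ∉ a ∷ b ∷ c ∷ [] →
      γ (merge w x y) a b c ≡ γ w (transpose x y a) (transpose x y b) (transpose x y c)
    γ-merge-away-from-target {a} {b} {c} (a≢b , a≢c , b≢c) y∉ with a≢y , b≢y , c≢y ← ∉⇒≢ y∉ =
      γ-cong {merge w x y} {w} {a} {b} {c}
        (merge-away-from-target w a≢b a≢y b≢y) (merge-away-from-target w a≢c a≢y c≢y)
        (merge-away-from-target w b≢c b≢y c≢y)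

    γ-merge-through-both : Symmetric w → x ≢ y → ∀ {a b c} → Distinct a b c →
      x ∈ a ∷ b ∷ c ∷ [] → y ∈ a ∷ b ∷ c ∷ [] → γ (merge w x y) a b c ≡ 0
    γ-merge-through-both w-sym x≢y distinct x∈ y∈ = by-positions distinct x∈ y∈
      where
      M = merge w x y
      M-sym = merge-symmetric w w-sym x≢y
      twins : ∀ {c} → c ≢ x → c ≢ y → γ M x y c ≡ 0
      twins {c} c≢x c≢y = γ-twins {M} {x} {y} {c} (merge-twins w x≢y c≢x c≢y)
      by-positions : ∀ {a b c} → Distinct a b c →
        x ∈ a ∷ b ∷ c ∷ [] → y ∈ a ∷ b ∷ c ∷ [] → γ M a b c ≡ 0
      by-positions _ (here x≡a) (here y≡a) = ⊥-elim (x≢y (trans x≡a (sym y≡a)))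
      by-positions _ (there (here x≡b)) (there (here y≡b)) = ⊥-elim (x≢y (trans x≡b (sym y≡b)))
      by-positions _ (there (there (here x≡c))) (there (there (here y≡c))) =
        ⊥-elim (x≢y (trans x≡c (sym y≡c)))
      by-positions (_ , x≢c , y≢c) (here refl) (there (here refl)) =
        twins (≢-sym x≢c) (≢-sym y≢c)
      by-positions {b = b} (x≢b , _ , b≢y) (here refl) (there (there (here refl))) =
        trans (γ-swap₂₃ M-sym x y b) (twins (≢-sym x≢b) b≢y)
      by-positions {c = c} (_ , y≢c , x≢c) (there (here refl)) (here refl) =
        trans (γ-swap₁₂ M-sym x y c) (twins (≢-sym x≢c) (≢-sym y≢c))
      by-positions {a = a} (a≢x , a≢y , _) (there (here refl)) (there (there (here refl))) =
        trans (γ-swap₁₂ M-sym x a y) (trans (γ-swap₂₃ M-sym x y a) (twins a≢x a≢y))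
      by-positions {b = b} (y≢b , _ , b≢x) (there (there (here refl))) (here refl) =
        trans (γ-swap₂₃ M-sym y x b) (trans (γ-swap₁₂ M-sym x y b) (twins b≢x (≢-sym y≢b)))
      by-positions {a = a} (a≢y , a≢x , _) (there (there (here refl))) (there (here refl)) =
        trans (γ-swap₁₂ M-sym y a x) (trans (γ-swap₂₃ M-sym y x a)
          (trans (γ-swap₁₂ M-sym x y a) (twins a≢x a≢y)))
      by-positions _ (there (there (there ()))) _
      by-positions _ _ (there (there (there ())))

module _ {n : ℕ} {w : Weight n} (w-sym : Symmetric w) {u v : Fin n} (u≢v : u ≢ v) where

  private
    σ : Fin n → Fin n
    σ = transpose u v

  γ-merges≤ : ∀ a b c →
    γ (merge w u v) a b c + γ (merge w v u) a b c ≤ γ w a b c + γ w (σ a) (σ b) (σ c)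
  γ-merges≤ a b c with distinct? a b c
  ... | no ¬distinct = ≤-trans (≤-reflexive (cong₂ _+_
          (γ-degenerate (merge-symmetric w w-sym u≢v) ¬distinct)
          (γ-degenerate (merge-symmetric w w-sym (≢-sym u≢v)) ¬distinct))) z≤n
  ... | yes distinct with any? (v ≟_) (a ∷ b ∷ c ∷ []) | any? (u ≟_) (a ∷ b ∷ c ∷ [])
  ...   | no v∉ | _ = ≤-reflexive (trans (cong₂ _+_
          (γ-merge-away-from-target w distinct v∉) (γ-merge-away-from-source w v∉))
          (+-comm (γ w (σ a) (σ b) (σ c)) (γ w a b c)))
  ...   | yes _ | no u∉ = ≤-reflexive (cong₂ _+_
          (γ-merge-away-from-source w u∉)
          (trans (γ-merge-away-from-target w distinct u∉)
                 (γ-resp-≗ w (transpose-comm v u) a b c)))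
  ...   | yes v∈ | yes u∈ = ≤-trans (≤-reflexive (cong₂ _+_
          (γ-merge-through-both w w-sym u≢v distinct u∈ v∈)
          (γ-merge-through-both w w-sym (≢-sym u≢v) distinct v∈ u∈))) z≤n

  merges-Γsize< : ∀ {z} → T (inΓ w (u , v , z)) →
    Γsize (merge w u v) + Γsize (merge w v u) < Γsize w + Γsize w
  merges-Γsize< {z} uvz∈Γ = *-cancelˡ-< 6 _ _ (begin-strict
    6 * (Γsize Muv + Γsize Mvu)
      ≡⟨ *-distribˡ-+ 6 (Γsize Muv) (Γsize Mvu) ⟩
    6 * Γsize Muv + 6 * Γsize Mvu
      ≡⟨ cong₂ _+_ (Σ³-γ (merge-symmetric w w-sym u≢v)) (Σ³-γ (merge-symmetric w w-sym (≢-sym u≢v))) ⟨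
    Σ³ (γ Muv) + Σ³ (γ Mvu)
      ≡⟨ Σ³-distrib-+ (γ Muv) (γ Mvu) ⟨
    Σ³ (λ a b c → γ Muv a b c + γ Mvu a b c)
      <⟨ Σ³-mono-< γ-merges≤ u v z at-uvz ⟩
    Σ³ (λ a b c → γ w a b c + γ w (σ a) (σ b) (σ c))
      ≡⟨ Σ³-distrib-+ (γ w) (λ a b c → γ w (σ a) (σ b) (σ c)) ⟩
    Σ³ (γ w) + Σ³ (λ a b c → γ w (σ a) (σ b) (σ c))
      ≡⟨ cong (Σ³ (γ w) +_) (Σ³-permute (γ w) (Perm.transpose u v)) ⟩
    Σ³ (γ w) + Σ³ (γ w)
      ≡⟨ cong₂ _+_ (Σ³-γ w-sym) (Σ³-γ w-sym) ⟩
    6 * Γsize w + 6 * Γsize w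
      ≡⟨ *-distribˡ-+ 6 (Γsize w) (Γsize w) ⟨
    6 * (Γsize w + Γsize w) ∎)
    where
    open ≤-Reasoning
    Muv = merge w u v
    Mvu = merge w v u
    uvz-distinct = inΓ⇒Distinct w-sym uvz∈Γ
    at-uvz : γ Muv u v z + γ Mvu u v z < γ w u v z + γ w (σ u) (σ v) (σ z)
    at-uvz = begin-strict
      γ Muv u v z + γ Mvu u v z
        ≡⟨ cong₂ _+_ (γ-merge-through-both w w-sym u≢v uvz-distinct (here refl) (there (here refl)))
                     (γ-merge-through-both w w-sym (≢-sym u≢v) uvz-distinct (there (here refl)) (here refl)) ⟩
      0               <⟨ z<s ⟩
      1               ≡⟨ 𝟙-true uvz∈Γ ⟨
      γ w u v z       ≤⟨ m≤m+n _ _ ⟩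
      γ w u v z + γ w (σ u) (σ v) (σ z) ∎

m+n<k+k⇒m<k⊎n<k : ∀ {m n k} → m + n < k + k → m < k ⊎ n < k
m+n<k+k⇒m<k⊎n<k {m} {n} {k} m+n<k+k with m ℕ.<? k
... | yes m<k = inj₁ m<k
... | no  m≮k = inj₂ (+-cancelˡ-< k n k (≤-<-trans (+-monoˡ-≤ n (≮⇒≥ m≮k)) m+n<k+k))

lemma5p4 : (n : ℕ) → n ≥ 1 → (w : Weight n) → Symmetric w → InD w →
    (u v z : Fin n) → ¬ u ≡ v → ¬ u ≡ z → ¬ v ≡ z →
    w u v ≡ 1 → w u z ≡ 2 → w v z ≡ 3 →
    Γsize (merge w u v) < Γsize w ⊎ Γsize (merge w v u) < Γsize w
lemma5p4 _ _ w w-sym _ u v z u≢v _ _ uv≡1 uz≡2 vz≡3 =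
  m+n<k+k⇒m<k⊎n<k (merges-Γsize< w-sym u≢v uvz∈Γ)
  where
  uvz∈Γ : T (inΓ w (u , v , z))
  uvz∈Γ rewrite uv≡1 | uz≡2 | vz≡3 = _
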